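{- Let $p\geq 2$ and let $G$ be a $K_{1,p+1}$-free $2p$-regular graph. Then $G$ is $(p+2)$-star colourable if and only if $G$ admits a locally bijective homomorphism to $L^*(K_{p+2})$.
   Context: Graphs are finite and simple. $K_{1,p+1}$-free means no induced subgraph isomorphic to $K_{1,p+1}$. A $k$-star colouring is a proper colouring with $k$ colours in which the subgraph induced by any two colour classes has every connected component a star $K_{1,q}$ ($q\ge 0$). $L^*(K_q)$ is the undirected graph with vertex set the ordered pairs $(i,j)$ of distinct elements of $\mathbb{Z}_q$, where $(i,j)$ and $(j,k)$ are adjacent whenever $k\neq i$ (it is the underlying graph of the oriented line graph of $K_q$). A locally bijective homomorphism from $G$ to $H$ is a map $\psi\colon V(G)\to V(H)$ such that for every $v\in V(G)$ the restriction of $\psi$ to $N_G(v)$ is a bijection onto $N_H(\psi(v))$. -}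

module Defs where

open import Data.Nat using (ℕ; zero; suc; _+_; _*_; _≤_)
open import Data.Bool using (Bool; true; false; T)
open import Data.Fin using (Fin)
open import Data.Fin.Subset using (Subset; ∣_∣)
open import Data.Vec using (tabulate)
open import Data.Product using (Σ; ∃; _×_; _,_; proj₁; proj₂)
open import Data.Sum using (_⊎_)
open import Relation.Binary.PropositionalEquality using (_≡_; _≢_)
open import Relation.Nullary using (¬_)
open import Function.Definitions using (Injective)

record Graph : Set where
  field
    n     : ℕ
    adj   : Fin n → Fin n → Bool
    sym   : ∀ u v → adj u v ≡ adj v u
    irrefl : ∀ v → adj v v ≡ false

module _ (G : Graph) where
  open Graph G

  Adj : Fin n → Fin n → Set
  Adj u v = T (adj u v)

  degree : Fin n → ℕ
  degree v = ∣ tabulate (adj v) ∣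

  Regular : ℕ → Set
  Regular d = ∀ v → degree v ≡ d

  InducedStar : ℕ → Set
  InducedStar m =
    Σ (Fin n) λ v → Σ (Fin m → Fin n) λ f →
      Injective _≡_ _≡_ f × (∀ i → Adj v (f i)) ×
      (∀ i j → ¬ Adj (f i) (f j))

  Free-K1 : ℕ → Set
  Free-K1 m = ¬ InducedStar m

  data Reach (P : Fin n → Set) (x : Fin n) : Fin n → Set where
    here : P x → Reach P x x
    step : ∀ {y z} → Reach P x y → Adj y z → P z → Reach P x z

  Proper : (k : ℕ) → (Fin n → Fin k) → Set
  Proper k c = ∀ u v → Adj u v → c u ≢ c v

  -- the component (in the subgraph induced by colour classes a and b)
  -- containing x is a star K_{1,q} (q ≥ 0) with some centre z:
  -- z lies in the component, every other vertex of the component is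
  -- adjacent to z, and no two non-centre vertices are adjacent.
  module _ (k : ℕ) (c : Fin n → Fin k) (a b : Fin k) where
    InAB : Fin n → Set
    InAB v = (c v ≡ a) ⊎ (c v ≡ b)

    ComponentIsStar : Fin n → Set
    ComponentIsStar x =
      Σ (Fin n) λ z → Reach InAB x z ×
        (∀ y → Reach InAB x y → y ≢ z → Adj z y) ×
        (∀ y w → Reach InAB x y → Reach InAB x w → y ≢ z → w ≢ z → ¬ Adj y w)

  StarColouring : (k : ℕ) → (Fin n → Fin k) → Set
  StarColouring k c =
    Proper k c × (∀ a b x → InAB k c a b x → ComponentIsStar k c a b x)

  StarColourable : ℕ → Set
  StarColourable k = Σ (Fin n → Fin k) λ c → StarColouring k c

-- L*(K_q): vertices are the ordered pairs (i , j) of Fin q with i ≢ j;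
-- (i,j) and (j,k) are adjacent whenever k ≢ i (undirected: either order).
LValid : (q : ℕ) → Fin q × Fin q → Set
LValid q (i , j) = i ≢ j

LAdj : (q : ℕ) → Fin q × Fin q → Fin q × Fin q → Set
LAdj q (i , j) (j' , k) = (j ≡ j' × k ≢ i) ⊎ (k ≡ i × j' ≢ j)

LocallyBijectiveToL* : (G : Graph) (q : ℕ) → (Fin (Graph.n G) → Fin q × Fin q) → Set
LocallyBijectiveToL* G q ψ =
  (∀ v → LValid q (ψ v)) ×
  (∀ v →
     (∀ u → Adj G v u → LAdj q (ψ v) (ψ u)) ×
     (∀ u w → Adj G v u → Adj G v w → ψ u ≡ ψ w → u ≡ w) ×
     (∀ y → LValid q y → LAdj q (ψ v) y → Σ (Fin (Graph.n G)) λ u → Adj G v u × ψ u ≡ y))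

-- Write ψ v = (c v , J v). Given a locally bijective ψ, colour v by c v: adjacent vertices of
-- L*(K_q) have distinct first coordinates, and in a two-coloured component a vertex x whose J x
-- is the other colour is the centre of a star, because each neighbour y of x in the component
-- has J y ≢ c x, so local injectivity at y leaves x as its only neighbour of colour c x.
--
-- Conversely, take a (p+2)-star colouring c of a 2p-regular graph and call an edge vu heavy at v
-- when v has at least two neighbours of colour c u. No edge is heavy at both ends (that would be a
-- two-coloured path on four vertices), and at most p edges are light at each vertex (otherwise
-- each of the p + 1 colours other than c v would occur once, giving only p + 1 < 2p neighbours).
-- Double counting then forces exactly p heavy edges at every vertex and one heavy end on every
-- edge: each v sees a single colour J v on p neighbours and every other colour on exactly one.
-- With ψ v = (c v , J v) this is a homomorphism to L*(K_{p+2}), and it is locally bijective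
-- since, by K_{1,p+1}-freeness, the values J y of the p neighbours y of colour J v are exactly
-- the p colours different from c v and J v.

module Submission where

open import Defs
open import Data.Nat using (ℕ; zero; suc; _+_; _*_; _≤_; _<_; z≤n; s≤s)
open import Data.Nat.Properties hiding (_≟_)
open import Data.Fin using (Fin; zero; suc; _≟_)
open import Data.Fin.Properties using (any?) renaming (suc-injective to Fin-suc-injective)
open import Data.Product using (Σ; ∃; ∃₂; _×_; _,_; proj₁; proj₂; map)
open import Data.Bool using (Bool; true; false; T)
open import Data.Vec using (tabulate)
open import Data.Fin.Subset using (∣_∣)
open import Data.Sum using (_⊎_; inj₁; inj₂; [_,_])
import Data.Sum as Sum
open import Data.Product.Properties using (×-≡,≡→≡)
open import Data.Empty using (⊥)
open import Level using (0ℓ)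
open import Function.Base using (_∘_; id)
open import Function.Bundles using (_⇔_; mk⇔)
open import Function.Definitions using (Injective)
open import Relation.Binary.PropositionalEquality hiding ([_])
open import Relation.Nullary using (¬_; ¬?; _×-dec_; Dec; yes; no; contradiction)
open import Relation.Nullary.Decidable using (T?)
open import Relation.Unary using (Pred; Decidable; _⊆_)
open import Relation.Unary.Properties using (_∪?_; _∩?_; ∁?)
open import Algebra.Properties.CommutativeMonoid.Sum +-0-commutativeMonoid
  using (sum; sum-cong-≗; ∑-distrib-+; ∑-comm; sum-replicate-zero)

private variable
  A B : Set
  m n : ℕ

sum-mono-≤ : {f g : Fin n → ℕ} → (∀ i → f i ≤ g i) → sum f ≤ sum g
sum-mono-≤ {zero}  f≤g = z≤n
sum-mono-≤ {suc n} f≤g = +-mono-≤ (f≤g zero) (sum-mono-≤ (f≤g ∘ suc))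

+-≤-tight : ∀ {a b c d} → a ≤ c → b ≤ d → c + d ≤ a + b → a ≡ c × b ≡ d
+-≤-tight {a} {b} {c} {d} a≤c b≤d c+d≤a+b =
  ≤-antisym a≤c (+-cancelʳ-≤ d c a (≤-trans c+d≤a+b (+-monoʳ-≤ a b≤d))) ,
  ≤-antisym b≤d (+-cancelˡ-≤ c d b (≤-trans c+d≤a+b (+-monoˡ-≤ b a≤c)))

sum-≤-tight : {f g : Fin n → ℕ} → (∀ i → f i ≤ g i) → sum g ≤ sum f → ∀ i → f i ≡ g i
sum-≤-tight f≤g ∑g≤∑f zero    = proj₁ (+-≤-tight (f≤g zero) (sum-mono-≤ (f≤g ∘ suc)) ∑g≤∑f)
sum-≤-tight {f = f} {g} f≤g ∑g≤∑f (suc i) = sum-≤-tight (f≤g ∘ suc) (≤-reflexive (sym ∑tails≡)) i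
  where ∑tails≡ : sum (f ∘ suc) ≡ sum (g ∘ suc)
        ∑tails≡ = proj₂ (+-≤-tight (f≤g zero) (sum-mono-≤ (f≤g ∘ suc)) ∑g≤∑f)

sum₂-≤-tight : {f g : Fin m → Fin n → ℕ} → (∀ i j → f i j ≤ g i j) →
  sum (λ i → sum (g i)) ≤ sum (λ i → sum (f i)) → ∀ i j → f i j ≡ g i j
sum₂-≤-tight f≤g ∑g≤∑f i = sum-≤-tight (f≤g i)
  (≤-reflexive (sym (sum-≤-tight (λ i → sum-mono-≤ (f≤g i)) ∑g≤∑f i)))

sum-pointwise : (f : Fin n → ℕ) (j : Fin n) → (∀ i → i ≢ j → f i ≡ 0) → sum f ≡ f j
sum-pointwise {suc n} f zero    f≡0 =
  trans (cong (f zero +_) (trans (sum-cong-≗ (λ i → f≡0 (suc i) λ ())) (sum-replicate-zero n)))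
        (+-identityʳ (f zero))
sum-pointwise {suc n} f (suc j) f≡0 =
  trans (cong (_+ sum (f ∘ suc)) (f≡0 zero λ ()))
        (sum-pointwise (f ∘ suc) j (λ i i≢j → f≡0 (suc i) (i≢j ∘ Fin-suc-injective)))

sum-pos⇒∃ : (f : Fin n → ℕ) → 0 < sum f → ∃ λ i → 0 < f i
sum-pos⇒∃ {suc n} f 0<∑ with 0 <? f zero
... | yes 0<f₀ = zero , 0<f₀
... | no 0≮f₀ = map suc id (sum-pos⇒∃ (f ∘ suc) 0<∑f∘suc)
  where 0<∑f∘suc : 0 < sum (f ∘ suc)
        0<∑f∘suc = subst (λ x → 0 < x + sum (f ∘ suc)) (n≤0⇒n≡0 (≮⇒≥ 0≮f₀)) 0<∑

-- Counting the elements of decidable subsets of Fin n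

𝟙 : Dec A → ℕ
𝟙 (yes _) = 1
𝟙 (no _)  = 0

𝟙-yes : (a? : Dec A) → A → 𝟙 a? ≡ 1
𝟙-yes (yes _) a = refl
𝟙-yes (no ¬a) a = contradiction a ¬a

𝟙-no : (a? : Dec A) → ¬ A → 𝟙 a? ≡ 0
𝟙-no (yes a) ¬a = contradiction a ¬a
𝟙-no (no _)  ¬a = refl

𝟙-mono : (a? : Dec A) (b? : Dec B) → (A → B) → 𝟙 a? ≤ 𝟙 b?
𝟙-mono (yes a) (yes _) A⇒B = ≤-refl
𝟙-mono (yes a) (no ¬b) A⇒B = contradiction (A⇒B a) ¬b
𝟙-mono (no _)  b?      A⇒B = z≤n

𝟙≡1⇒ : (a? : Dec A) → 𝟙 a? ≡ 1 → A
𝟙≡1⇒ (yes a) _ = a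

𝟙≤1 : (a? : Dec A) → 𝟙 a? ≤ 1
𝟙≤1 (yes _) = ≤-refl
𝟙≤1 (no _)  = z≤n

𝟙-cong : (a? : Dec A) (b? : Dec B) → (A → B) → (B → A) → 𝟙 a? ≡ 𝟙 b?
𝟙-cong a? b? A⇒B B⇒A = ≤-antisym (𝟙-mono a? b? A⇒B) (𝟙-mono b? a? B⇒A)

count : {P : Pred (Fin n) 0ℓ} → Decidable P → ℕ
count P? = sum (𝟙 ∘ P?)

sum-const-1 : ∀ n → sum {n} (λ _ → 1) ≡ n
sum-const-1 zero    = refl
sum-const-1 (suc n) = cong suc (sum-const-1 n)

module _ {P Q : Pred (Fin n) 0ℓ} (P? : Decidable P) (Q? : Decidable Q) where

  count-mono : P ⊆ Q → count P? ≤ count Q?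
  count-mono P⊆Q = sum-mono-≤ (λ i → 𝟙-mono (P? i) (Q? i) P⊆Q)

  count-cong : P ⊆ Q → Q ⊆ P → count P? ≡ count Q?
  count-cong P⊆Q Q⊆P = sum-cong-≗ (λ i → 𝟙-cong (P? i) (Q? i) P⊆Q Q⊆P)

  count-∪ : (∀ {i} → P i → ¬ Q i) → count (P? ∪? Q?) ≡ count P? + count Q?
  count-∪ disjoint = trans (sum-cong-≗ 𝟙-∪) (∑-distrib-+ (𝟙 ∘ P?) (𝟙 ∘ Q?))
    where
    𝟙-∪ : ∀ i → 𝟙 ((P? ∪? Q?) i) ≡ 𝟙 (P? i) + 𝟙 (Q? i)
    𝟙-∪ i with P? i | Q? i
    ... | yes p | yes q = contradiction q (disjoint p)
    ... | yes _ | no _  = refl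
    ... | no _  | yes _ = refl
    ... | no _  | no _  = refl

module _ {P : Pred (Fin n) 0ℓ} (P? : Decidable P) where

  count-∅ : (∀ i → ¬ P i) → count P? ≡ 0
  count-∅ ¬P = trans (sum-cong-≗ (λ i → 𝟙-no (P? i) (¬P i))) (sum-replicate-zero n)

  count-∁ : count P? + count (∁? P?) ≡ n
  count-∁ = trans (sym (∑-distrib-+ (𝟙 ∘ P?) (𝟙 ∘ ∁? P?)))
                  (trans (sum-cong-≗ 𝟙-∁) (sum-const-1 n))
    where
    𝟙-∁ : ∀ i → 𝟙 (P? i) + 𝟙 (∁? P? i) ≡ 1
    𝟙-∁ i with P? i
    ... | yes _ = refl
    ... | no _  = refl

  count-pos⇒∃ : 0 < count P? → ∃ P
  count-pos⇒∃ 0<count with i , 0<𝟙 ← sum-pos⇒∃ (𝟙 ∘ P?) 0<count with P? i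
  ... | yes p = i , p

  count-fibres : (c : Fin n → Fin m) →
                 count P? ≡ sum (λ k → count (P? ∩? (λ i → c i ≟ k)))
  count-fibres c = trans (sum-cong-≗ 𝟙-fibres) (∑-comm (λ i k → 𝟙 ((P? ∩? (λ i → c i ≟ k)) i)))
    where
    𝟙-fibres : ∀ i → 𝟙 (P? i) ≡ sum (λ k → 𝟙 ((P? ∩? (λ i → c i ≟ k)) i))
    𝟙-fibres i = sym (trans (sum-pointwise _ (c i) off-fibre) on-fibre)
      where
      off-fibre : ∀ k → k ≢ c i → 𝟙 ((P? ∩? (λ i → c i ≟ k)) i) ≡ 0
      off-fibre k k≢ci = 𝟙-no ((P? ∩? (λ i → c i ≟ k)) i) (λ (_ , ci≡k) → k≢ci (sym ci≡k))
      on-fibre : 𝟙 ((P? ∩? (λ i → c i ≟ c i)) i) ≡ 𝟙 (P? i)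
      on-fibre = 𝟙-cong ((P? ∩? (λ i → c i ≟ c i)) i) (P? i) proj₁ (_, refl)

count-singleton : (j : Fin n) → count (_≟ j) ≡ 1
count-singleton j = trans (sum-pointwise _ j (λ i i≢j → 𝟙-no (i ≟ j) i≢j)) (𝟙-yes (j ≟ j) refl)

module _ {P : Pred (Fin n) 0ℓ} (P? : Decidable P) where

  ∈⇒count-pos : ∀ {i} → P i → 0 < count P?
  ∈⇒count-pos {i} p = subst (_≤ count P?) (count-singleton i)
    (count-mono (_≟ i) P? (λ { refl → p }))

  count≡0⇒∉ : count P? ≡ 0 → ∀ {i} → ¬ P i
  count≡0⇒∉ count≡0 p = contradiction (subst (0 <_) count≡0 (∈⇒count-pos p)) λ ()

  count≤1⇒unique : count P? ≤ 1 → ∀ {i j} → P i → P j → i ≡ j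
  count≤1⇒unique count≤1 {i} {j} pi pj with i ≟ j
  ... | yes i≡j = i≡j
  ... | no i≢j = contradiction (≤-trans two≤count count≤1) λ { (s≤s ()) }
    where
    two≤count : 2 ≤ count P?
    two≤count = begin
      2                                ≡⟨ sym (cong₂ _+_ (count-singleton i) (count-singleton j)) ⟩
      count (_≟ i) + count (_≟ j)      ≡⟨ sym (count-∪ (_≟ i) (_≟ j) (λ { refl refl → i≢j refl })) ⟩
      count ((_≟ i) ∪? (_≟ j))         ≤⟨ count-mono _ P? (λ { (inj₁ refl) → pi ; (inj₂ refl) → pj }) ⟩
      count P?                         ∎
      where open ≤-Reasoning

  2≤count⇒distinct : 2 ≤ count P? → ∃₂ λ i j → i ≢ j × P i × P j
  2≤count⇒distinct 2≤count with i , pi ← count-pos⇒∃ P? (≤-trans (s≤s z≤n) 2≤count)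
    with any? (P? ∩? (λ j → ¬? (j ≟ i)))
  ... | yes (j , pj , j≢i) = i , j , (λ i≡j → j≢i (sym i≡j)) , pi , pj
  ... | no ∄j = contradiction (≤-trans 2≤count count≤1) λ { (s≤s ()) }
    where
    only-i : P ⊆ (_≡ i)
    only-i {j} pj with j ≟ i
    ... | yes j≡i = j≡i
    ... | no j≢i = contradiction (j , pj , j≢i) ∄j
    count≤1 : count P? ≤ 1
    count≤1 = ≤-trans (count-mono P? (_≟ i) only-i) (≤-reflexive (count-singleton i))

enumerate : {P : Pred (Fin n) 0ℓ} (P? : Decidable P) →
            Σ (Fin (count P?) → Fin n) λ e → Injective _≡_ _≡_ e × (∀ k → P (e k))
enumerate {zero}  P? = (λ ()) , (λ { {()} }) , (λ ())
enumerate {suc n} {P} P? with P? zero | enumerate (P? ∘ suc)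
... | no _   | e , e-inj , e∈P = suc ∘ e , e-inj ∘ Fin-suc-injective , e∈P
... | yes p₀ | e , e-inj , e∈P = e′ , e′-inj , e′∈P
  where
  e′ : Fin (suc (count (P? ∘ suc))) → Fin (suc n)
  e′ zero    = zero
  e′ (suc k) = suc (e k)
  e′-inj : Injective _≡_ _≡_ e′
  e′-inj {zero}  {zero}  _ = refl
  e′-inj {suc k} {suc l} e′k≡e′l = cong suc (e-inj (Fin-suc-injective e′k≡e′l))
  e′∈P : ∀ k → P (e′ k)
  e′∈P zero    = p₀
  e′∈P (suc k) = e∈P k

count-≢ : (a : Fin n) → count (∁? (_≟ a)) + 1 ≡ n
count-≢ {n} a = begin
  count (∁? (_≟ a)) + 1             ≡⟨ +-comm (count (∁? (_≟ a))) 1 ⟩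
  1 + count (∁? (_≟ a))             ≡⟨ cong (_+ count (∁? (_≟ a))) (sym (count-singleton a)) ⟩
  count (_≟ a) + count (∁? (_≟ a))  ≡⟨ count-∁ (_≟ a) ⟩
  n                                 ∎
  where open ≡-Reasoning

count-∉₂ : {a b : Fin n} → a ≢ b → count (∁? ((_≟ a) ∪? (_≟ b))) + 2 ≡ n
count-∉₂ {n} {a} {b} a≢b = begin
  count (∁? a∨b) + 2                  ≡⟨ +-comm (count (∁? a∨b)) 2 ⟩
  2 + count (∁? a∨b)                  ≡⟨ cong (_+ count (∁? a∨b)) (sym count-a∨b) ⟩
  count a∨b + count (∁? a∨b)          ≡⟨ count-∁ a∨b ⟩
  n                                   ∎
  where
  open ≡-Reasoning
  a∨b : Decidable (λ k → k ≡ a ⊎ k ≡ b)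
  a∨b = (_≟ a) ∪? (_≟ b)
  count-a∨b : count a∨b ≡ 2
  count-a∨b = trans (count-∪ (_≟ a) (_≟ b) (λ { refl refl → a≢b refl }))
                    (cong₂ _+_ (count-singleton a) (count-singleton b))

count-fibres-on : {P : Pred (Fin n) 0ℓ} {Q : Pred (Fin m) 0ℓ} (P? : Decidable P) (Q? : Decidable Q)
  (c : Fin n → Fin m) → count (P? ∩? (Q? ∘ c)) ≡ sum (λ k → 𝟙 (Q? k) * count (P? ∩? (λ i → c i ≟ k)))
count-fibres-on {P = P} {Q} P? Q? c = trans (count-fibres (P? ∩? (Q? ∘ c)) c) (sum-cong-≗ fibre)
  where
  fibre : ∀ k → count ((P? ∩? (Q? ∘ c)) ∩? (λ i → c i ≟ k)) ≡ 𝟙 (Q? k) * count (P? ∩? (λ i → c i ≟ k))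
  fibre k with Q? k
  ... | yes qk = trans (count-cong ((P? ∩? (Q? ∘ c)) ∩? (λ i → c i ≟ k)) (P? ∩? (λ i → c i ≟ k))
                                   (λ ((p , _) , ci≡k) → p , ci≡k) (λ { (p , refl) → (p , qk) , refl }))
                       (sym (+-identityʳ _))
  ... | no ¬qk = count-∅ ((P? ∩? (Q? ∘ c)) ∩? (λ i → c i ≟ k)) (λ { i ((_ , qci) , refl) → ¬qk qci })

∣tabulate∣≡count : (f : Fin n → Bool) → ∣ tabulate f ∣ ≡ count (T? ∘ f)
∣tabulate∣≡count {zero}  f = refl
∣tabulate∣≡count {suc n} f with f zero
... | true  = cong suc (∣tabulate∣≡count (f ∘ suc))
... | false = ∣tabulate∣≡count (f ∘ suc)

module _ (G : Graph) where
  open Graph G using (adj)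

  private
    V : Set
    V = Fin (Graph.n G)

  private variable
    u v w x y z : V
    P : V → Set

  Adj? : (v : V) → Decidable (Adj G v)
  Adj? v u = T? (adj v u)

  Adj-sym : Adj G u v → Adj G v u
  Adj-sym {u} {v} = subst T (Graph.sym G u v)

  Adj-irrefl : ¬ Adj G v v
  Adj-irrefl {v} = subst T (Graph.irrefl G v)

  degree≡count : ∀ v → degree G v ≡ count (Adj? v)
  degree≡count v = ∣tabulate∣≡count (adj v)

  Reach-target : Reach G P x y → P y
  Reach-target (here px)    = px
  Reach-target (step _ _ pz) = pz

  Reach-trans : Reach G P x y → Reach G P y z → Reach G P x z
  Reach-trans r (here _)       = r
  Reach-trans r (step r′ a pz) = step (Reach-trans r r′) a pz

  Reach-sym : Reach G P x y → Reach G P y x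
  Reach-sym (here px)     = here px
  Reach-sym (step r a pz) = Reach-trans (step (here pz) (Adj-sym a) (Reach-target r)) (Reach-sym r)

  IsStarComponent : (P : V → Set) → V → Set
  IsStarComponent P x =
    Σ V λ z → Reach G P x z ×
      (∀ y → Reach G P x y → y ≢ z → Adj G z y) ×
      (∀ y w → Reach G P x y → Reach G P x w → y ≢ z → w ≢ z → ¬ Adj G y w)

  IsStarComponent-transfer : Reach G P x w → IsStarComponent P w → IsStarComponent P x
  IsStarComponent-transfer {P = P} {x = x} {w = w} x⇝w (z , w⇝z , leaf , indep) =
    z , Reach-trans x⇝w w⇝z ,
    (λ y x⇝y → leaf y (w⇝ x⇝y)) ,
    (λ y y′ x⇝y x⇝y′ → indep y y′ (w⇝ x⇝y) (w⇝ x⇝y′))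
    where w⇝ : ∀ {y} → Reach G P x y → Reach G P w y
          w⇝ = Reach-trans (Reach-sym x⇝w)

  star-around : (Q : V → Set) → (∀ {y w} → Q y → Q w → ¬ Adj G y w) →
    Reach G P x z → (∀ y → Reach G P x y → y ≡ z ⊎ (Adj G z y × Q y)) → IsStarComponent P x
  star-around {P = P} {x = x} {z = z} Q Q-indep x⇝z centred = z , x⇝z , leaf , indep
    where
    leaf : ∀ y → Reach G P x y → y ≢ z → Adj G z y
    leaf y x⇝y y≢z with centred y x⇝y
    ... | inj₁ y≡z     = contradiction y≡z y≢z
    ... | inj₂ (zy , _) = zy
    indep : ∀ y w → Reach G P x y → Reach G P x w → y ≢ z → w ≢ z → ¬ Adj G y w
    indep y w x⇝y x⇝w y≢z w≢z with centred y x⇝y | centred w x⇝w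
    ... | inj₁ y≡z     | _             = contradiction y≡z y≢z
    ... | _            | inj₁ w≡z      = contradiction w≡z w≢z
    ... | inj₂ (_ , qy) | inj₂ (_ , qw) = Q-indep qy qw

  star-centre : IsStarComponent P x → V
  star-centre = proj₁

  two-neighbours⇒centre : (S : IsStarComponent P x) → Reach G P x y →
    w ≢ z → Adj G y w → Adj G y z → P w → P z → y ≡ star-centre S
  two-neighbours⇒centre {P = P} {x = x} {y = y} {w = w} {z = z} (c , _ , _ , indep) x⇝y w≢z yw yz pw pz
    with y ≟ c
  ... | yes y≡c = y≡c
  ... | no y≢c  = contradiction (trans (neighbour≡c yw pw) (sym (neighbour≡c yz pz))) w≢z
    where
    neighbour≡c : ∀ {u} → Adj G y u → P u → u ≡ c
    neighbour≡c {u} yu pu with u ≟ c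
    ... | yes u≡c = u≡c
    ... | no u≢c  = contradiction yu (indep y u x⇝y (step x⇝y yu pu) y≢c u≢c)

  inducedStar-of-count : {Q : Pred V 0ℓ} (Q? : Decidable Q) (v : V) → (∀ {y} → Q y → Adj G v y) →
    (∀ {y w} → Q y → Q w → ¬ Adj G y w) → InducedStar G (count Q?)
  inducedStar-of-count Q? v Q⊆N Q-indep with e , e-inj , e∈Q ← enumerate Q? =
    v , e , e-inj , (λ i → Q⊆N (e∈Q i)) , (λ i j → Q-indep (e∈Q i) (e∈Q j))

-- Locally bijective homomorphisms to L*(K_q) give star colourings

module _ {q : ℕ} where

  L*-adj⇒proj₁≢ : ∀ {x y} → LValid q x → LValid q y → LAdj q x y → proj₁ x ≢ proj₁ y
  L*-adj⇒proj₁≢ vx vy (inj₁ (j≡j′ , _)) i≡j′ = vx (trans i≡j′ (sym j≡j′))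
  L*-adj⇒proj₁≢ vx vy (inj₂ (k≡i , _)) i≡j′ = vy (trans (sym i≡j′) (sym k≡i))

  L*-in-neighbour : ∀ {x y} → LAdj q x y → proj₁ y ≢ proj₂ x → proj₂ y ≡ proj₁ x
  L*-in-neighbour (inj₁ (j≡j′ , _)) j′≢j = contradiction (sym j≡j′) j′≢j
  L*-in-neighbour (inj₂ (k≡i , _))  _    = k≡i

  L*-out-neighbour : ∀ {x y} → LAdj q x y → proj₁ y ≡ proj₂ x → proj₂ y ≢ proj₁ x
  L*-out-neighbour (inj₁ (_ , k≢i))  _     = k≢i
  L*-out-neighbour (inj₂ (_ , j′≢j)) j′≡j = contradiction j′≡j j′≢j

module FromLocallyBijective (G : Graph) (q : ℕ) (ψ : Fin (Graph.n G) → Fin q × Fin q)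
                            (ψ-lb : LocallyBijectiveToL* G q ψ) where

  private
    V : Set
    V = Fin (Graph.n G)

    variable
      u v w x y z : V
      P : V → Set
      s t : Fin q

  colour pointer : V → Fin q
  colour  = proj₁ ∘ ψ
  pointer = proj₂ ∘ ψ

  ψ-hom : Adj G v u → LAdj q (ψ v) (ψ u)
  ψ-hom {v} = proj₁ (proj₂ ψ-lb v) _

  ψ-injective-on-N : Adj G v u → Adj G v w → ψ u ≡ ψ w → u ≡ w
  ψ-injective-on-N {v} = proj₁ (proj₂ (proj₂ ψ-lb v)) _ _

  colour-proper : Proper G q colour
  colour-proper u v uv = L*-adj⇒proj₁≢ (proj₁ ψ-lb u) (proj₁ ψ-lb v) (ψ-hom uv)

  Bicoloured : (V → Set) → Fin q → Fin q → Set
  Bicoloured P s t = ∀ y → (P y → colour y ≡ s ⊎ colour y ≡ t) × (colour y ≡ s ⊎ colour y ≡ t → P y)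

  Bicoloured-swap : Bicoloured P s t → Bicoloured P t s
  Bicoloured-swap P≡st y = Sum.swap ∘ proj₁ (P≡st y) , proj₂ (P≡st y) ∘ Sum.swap

  opposite-colour : Bicoloured P s t → Adj G y z → colour y ≡ s → P z → colour z ≡ t
  opposite-colour {y = y} {z = z} P≡st yz cy≡s pz with proj₁ (P≡st z) pz
  ... | inj₁ cz≡s = contradiction (trans cy≡s (sym cz≡s)) (colour-proper y z yz)
  ... | inj₂ cz≡t = cz≡t

  centre-star : Bicoloured P s t → P x → colour x ≡ s → pointer x ≡ t → IsStarComponent G P x
  centre-star {P = P} {s = s} {t = t} {x = x} P≡st px cx≡s px≡t =
    star-around G (λ y → colour y ≡ t) indep (here px) centred
    where
    indep : ∀ {y w} → colour y ≡ t → colour w ≡ t → ¬ Adj G y w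
    indep {y} {w} cy≡t cw≡t yw = colour-proper y w yw (trans cy≡t (sym cw≡t))

    centred : ∀ y → Reach G P x y → y ≡ x ⊎ (Adj G x y × colour y ≡ t)
    centred y (here _) = inj₁ refl
    centred z (step {y} x⇝y yz pz) with centred y x⇝y
    ... | inj₁ refl = inj₂ (yz , opposite-colour P≡st yz cx≡s pz)
    ... | inj₂ (xy , cy≡t) = inj₁ (ψ-injective-on-N yz (Adj-sym G xy) (×-≡,≡→≡ (cz≡cx , pz≡px)))
      where
      cz≡cx : colour z ≡ colour x
      cz≡cx = trans (opposite-colour (Bicoloured-swap P≡st) yz cy≡t pz) (sym cx≡s)
      py≢cx : pointer y ≢ colour x
      py≢cx = L*-out-neighbour (ψ-hom xy) (trans cy≡t (sym px≡t))
      pz≡px : pointer z ≡ pointer x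
      pz≡px = trans (L*-in-neighbour (ψ-hom yz) (λ cz≡py → py≢cx (trans (sym cz≡py) cz≡cx)))
                    (trans cy≡t (sym px≡t))

  star-component : Bicoloured P s t → P x → colour x ≡ s → IsStarComponent G P x
  star-component {P = P} {s = s} {t = t} {x = x} P≡st px cx≡s with pointer x ≟ t
  ... | yes px≡t = centre-star P≡st px cx≡s px≡t
  ... | no px≢t with any? (λ w → Adj? G x w ×-dec (colour w ≟ t))
  ...   | yes (w , xw , cw≡t) =
    IsStarComponent-transfer G (step (here px) xw (proj₂ (P≡st w) (inj₂ cw≡t)))
      (centre-star (Bicoloured-swap P≡st) (proj₂ (P≡st w) (inj₂ cw≡t)) cw≡t pw≡s)
    where pw≡s : pointer w ≡ s
          pw≡s = trans (L*-in-neighbour (ψ-hom xw) (λ cw≡px → px≢t (trans (sym cw≡px) cw≡t))) cx≡s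
  ...   | no ∄w = star-around G (λ _ → ⊥) (λ ()) (here px) isolated
    where
    isolated : ∀ y → Reach G P x y → y ≡ x ⊎ (Adj G x y × ⊥)
    isolated y (here _) = inj₁ refl
    isolated z (step {y} x⇝y yz pz) with isolated y x⇝y
    ... | inj₁ refl = contradiction (z , yz , opposite-colour P≡st yz cx≡s pz) ∄w

  star-colouring : StarColouring G q colour
  star-colouring = colour-proper , bicoloured-star
    where
    bicoloured-star : ∀ a b x → InAB G q colour a b x → ComponentIsStar G q colour a b x
    bicoloured-star a b x x∈ab@(inj₁ cx≡a) = star-component (λ _ → id , id) x∈ab cx≡a
    bicoloured-star a b x x∈ab@(inj₂ cx≡b) = star-component (Bicoloured-swap (λ _ → id , id)) x∈ab cx≡b

-- Star colourings give locally bijective homomorphisms to L*(K_{p+2})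

lightPart heavyPart : ℕ → ℕ
lightPart 1 = 1
lightPart _ = 0
heavyPart 0 = 0
heavyPart 1 = 0
heavyPart x = x

lightPart+heavyPart : ∀ x → lightPart x + heavyPart x ≡ x
lightPart+heavyPart 0             = refl
lightPart+heavyPart 1             = refl
lightPart+heavyPart (suc (suc x)) = refl

lightPart≤1 : ∀ x → lightPart x ≤ 1
lightPart≤1 0             = z≤n
lightPart≤1 1             = ≤-refl
lightPart≤1 (suc (suc x)) = z≤n

lightPart≡1⇒≡1 : ∀ {x} → lightPart x ≡ 1 → x ≡ 1
lightPart≡1⇒≡1 {1} _ = refl

lightPart-heavy : ∀ {x} → 2 ≤ x → lightPart x ≡ 0
lightPart-heavy (s≤s (s≤s _)) = refl

heavyPart-heavy : ∀ {x} → 2 ≤ x → heavyPart x ≡ x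
heavyPart-heavy (s≤s (s≤s _)) = refl

heavyPart-pos : ∀ {x} → 0 < heavyPart x → 2 ≤ x
heavyPart-pos {suc (suc x)} _ = s≤s (s≤s z≤n)

𝟙-heavy*≡heavyPart : ∀ x → 𝟙 (2 ≤? x) * x ≡ heavyPart x
𝟙-heavy*≡heavyPart 0             = refl
𝟙-heavy*≡heavyPart 1             = refl
𝟙-heavy*≡heavyPart (suc (suc x)) = +-identityʳ (suc (suc x))

𝟙-light*≡lightPart : ∀ x → 𝟙 (¬? (2 ≤? x)) * x ≡ lightPart x
𝟙-light*≡lightPart 0             = refl
𝟙-light*≡lightPart 1             = refl
𝟙-light*≡lightPart (suc (suc x)) = refl

-- f is the colour-degree profile k ↦ #{neighbours of colour k} of a vertex of colour a.
module Profile {m} (f : Fin m → ℕ) {a : Fin m} (fa≡0 : f a ≡ 0) where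

  light heavy : ℕ
  light = sum (lightPart ∘ f)
  heavy = sum (heavyPart ∘ f)

  light+heavy : light + heavy ≡ sum f
  light+heavy = trans (sym (∑-distrib-+ (lightPart ∘ f) (heavyPart ∘ f))) (sum-cong-≗ (lightPart+heavyPart ∘ f))

  heavy-pos⇒∃ : 0 < heavy → ∃ λ J → 2 ≤ f J
  heavy-pos⇒∃ 0<heavy with J , 0<hJ ← sum-pos⇒∃ (heavyPart ∘ f) 0<heavy = J , heavyPart-pos 0<hJ

  light≤other : ∀ k → lightPart (f k) ≤ 𝟙 (∁? (_≟ a) k)
  light≤other k with k ≟ a
  ... | yes refl = subst (λ x → lightPart x ≤ 0) (sym fa≡0) z≤n
  ... | no _     = lightPart≤1 (f k)

  others≤light⇒sum≡others : count (∁? (_≟ a)) ≤ light → sum f ≡ count (∁? (_≟ a))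
  others≤light⇒sum≡others others≤light = sum-cong-≗ f≡𝟙
    where
    f≡𝟙 : ∀ k → f k ≡ 𝟙 (∁? (_≟ a) k)
    f≡𝟙 k with k ≟ a | sum-≤-tight light≤other others≤light k
    ... | yes refl | _       = fa≡0
    ... | no _     | light≡1 = lightPart≡1⇒≡1 light≡1

  module _ {J : Fin m} (2≤fJ : 2 ≤ f J) where

    private
      Rest : Fin m → Set
      Rest k = ¬ (k ≡ a ⊎ k ≡ J)

      Rest? : Decidable Rest
      Rest? = ∁? ((_≟ a) ∪? (_≟ J))

    light≤rest : ∀ k → lightPart (f k) ≤ 𝟙 (Rest? k)
    light≤rest k with k ≟ a | k ≟ J
    ... | yes refl | _        = subst (λ x → lightPart x ≤ 0) (sym fa≡0) z≤n
    ... | no _     | yes refl = ≤-reflexive (lightPart-heavy 2≤fJ)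
    ... | no _     | no _     = lightPart≤1 (f k)

    rest≤light⇒ones : count Rest? ≤ light → ∀ k → Rest k → f k ≡ 1
    rest≤light⇒ones rest≤light k k∉aJ =
      lightPart≡1⇒≡1 (trans (sum-≤-tight light≤rest rest≤light k) (𝟙-yes (Rest? k) k∉aJ))

    rest≤light⇒heavy≡ : count Rest? ≤ light → heavy ≡ f J
    rest≤light⇒heavy≡ rest≤light =
      trans (sum-pointwise (heavyPart ∘ f) J light-off-J) (heavyPart-heavy 2≤fJ)
      where
      light-off-J : ∀ k → k ≢ J → heavyPart (f k) ≡ 0
      light-off-J k k≢J with k ≟ a
      ... | yes refl = cong heavyPart fa≡0
      ... | no k≢a   = cong heavyPart (rest≤light⇒ones rest≤light k [ k≢a , k≢J ])

module FromStarColouring (p : ℕ) (2≤p : 2 ≤ p) (G : Graph) (K-free : Free-K1 G (p + 1))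
                         (regular : Regular G (2 * p)) (c : Fin (Graph.n G) → Fin (p + 2))
                         (c-star : StarColouring G (p + 2) c) where

  private
    V : Set
    V = Fin (Graph.n G)

    variable
      u v w : V
      k : Fin (p + 2)

  c-proper : Proper G (p + 2) c
  c-proper = proj₁ c-star

  colourNbr? : (v : V) (k : Fin (p + 2)) → Decidable (λ u → Adj G v u × c u ≡ k)
  colourNbr? v k = Adj? G v ∩? (λ u → c u ≟ k)

  deg : V → Fin (p + 2) → ℕ
  deg v k = count (colourNbr? v k)

  Heavy : V → V → Set
  Heavy v u = 2 ≤ deg v (c u)

  deg-own-colour : ∀ v → deg v (c v) ≡ 0
  deg-own-colour v = count-∅ (colourNbr? v (c v)) (λ u (vu , cu≡cv) → c-proper v u vu (sym cu≡cv))

  sum-deg : ∀ v → sum (deg v) ≡ 2 * p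
  sum-deg v = trans (sym (count-fibres (Adj? G v) c)) (trans (sym (degree≡count G v)) (regular v))

  -- An edge heavy at both ends would give a bicoloured component with two centres.
  ¬heavy-at-both-ends : Adj G v u → Heavy v u → Heavy u v → ⊥
  ¬heavy-at-both-ends {v} {u} vu heavy-v heavy-u
    with S ← proj₂ c-star (c u) (c v) u (inj₁ refl)
       | w₁ , w₂ , w₁≢w₂ , (uw₁ , cw₁) , (uw₂ , cw₂) ← 2≤count⇒distinct (colourNbr? u (c v)) heavy-u
       | y₁ , y₂ , y₁≢y₂ , (vy₁ , cy₁) , (vy₂ , cy₂) ← 2≤count⇒distinct (colourNbr? v (c u)) heavy-v
    = Adj-irrefl G (subst (Adj G v) (trans u≡centre (sym v≡centre)) vu)
    where
    u⇝v : Reach G (InAB G (p + 2) c (c u) (c v)) u v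
    u⇝v = step (here (inj₁ refl)) (Adj-sym G vu) (inj₂ refl)
    u≡centre : u ≡ star-centre G S
    u≡centre = two-neighbours⇒centre G S (here (inj₁ refl)) w₁≢w₂ uw₁ uw₂ (inj₂ cw₁) (inj₂ cw₂)
    v≡centre : v ≡ star-centre G S
    v≡centre = two-neighbours⇒centre G S u⇝v y₁≢y₂ vy₁ vy₂ (inj₁ cy₁) (inj₁ cy₂)

  heavy? : (v : V) → Decidable (λ k → 2 ≤ deg v k)
  heavy? v k = 2 ≤? deg v k

  heavyEnd? : (v : V) → Decidable (λ u → Adj G v u × Heavy v u)
  heavyEnd? v = Adj? G v ∩? (heavy? v ∘ c)

  lightEnd? : (v : V) → Decidable (λ u → Adj G v u × ¬ Heavy v u)
  lightEnd? v = Adj? G v ∩? (∁? (heavy? v) ∘ c)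

  heavyEnds lightEnds : V → ℕ
  heavyEnds v = count (heavyEnd? v)
  lightEnds v = count (lightEnd? v)

  module _ (v : V) where
    open Profile (deg v) (deg-own-colour v)

    heavyEnds≡heavy : heavyEnds v ≡ heavy
    heavyEnds≡heavy = trans (count-fibres-on (Adj? G v) (heavy? v) c) (sum-cong-≗ (𝟙-heavy*≡heavyPart ∘ deg v))

    lightEnds≡light : lightEnds v ≡ light
    lightEnds≡light = trans (count-fibres-on (Adj? G v) (∁? (heavy? v)) c) (sum-cong-≗ (𝟙-light*≡lightPart ∘ deg v))

    heavyEnds+lightEnds : lightEnds v + heavyEnds v ≡ 2 * p
    heavyEnds+lightEnds = trans (cong₂ _+_ lightEnds≡light heavyEnds≡heavy) (trans light+heavy (sum-deg v))

    lightEnds≤p : lightEnds v ≤ p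
    lightEnds≤p with lightEnds v ≤? p
    ... | yes light≤p = light≤p
    ... | no light≰p = contradiction 2p≡p+1 (2p≢p+1)
      where
      others≡p+1 : count (∁? (_≟ c v)) ≡ p + 1
      others≡p+1 = +-cancelʳ-≡ 1 _ (p + 1) (trans (count-≢ (c v)) (sym (+-assoc p 1 1)))
      2p≡p+1 : 2 * p ≡ p + 1
      2p≡p+1 = trans (sym (sum-deg v)) (trans (others≤light⇒sum≡others
        (subst₂ _≤_ (trans (+-comm 1 p) (sym others≡p+1)) lightEnds≡light (≰⇒> light≰p))) others≡p+1)
      2p≢p+1 : 2 * p ≢ p + 1
      2p≢p+1 2p≡p+1 = <⇒≱ 2≤p (≤-reflexive (trans (sym (+-identityʳ p)) (+-cancelˡ-≡ p (p + 0) 1 2p≡p+1)))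

    p≤heavyEnds : p ≤ heavyEnds v
    p≤heavyEnds = +-cancelˡ-≤ p p (heavyEnds v) (begin
      p + p                       ≡⟨ cong (p +_) (sym (+-identityʳ p)) ⟩
      2 * p                       ≡⟨ sym heavyEnds+lightEnds ⟩
      lightEnds v + heavyEnds v   ≤⟨ +-monoˡ-≤ (heavyEnds v) lightEnds≤p ⟩
      p + heavyEnds v             ∎)
      where open ≤-Reasoning

  heavyEnd lightEnd : V → V → ℕ
  heavyEnd v u = 𝟙 (heavyEnd? v u)
  lightEnd v u = 𝟙 (lightEnd? u v)

  heavyEnd≤lightEnd : ∀ v u → heavyEnd v u ≤ lightEnd v u
  heavyEnd≤lightEnd v u = 𝟙-mono (heavyEnd? v u) (lightEnd? u v)
    (λ (vu , heavy-v) → Adj-sym G vu , ¬heavy-at-both-ends vu heavy-v)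

  ∑lightEnd≡∑lightEnds : sum (λ v → sum (lightEnd v)) ≡ sum lightEnds
  ∑lightEnd≡∑lightEnds = ∑-comm lightEnd

  ∑heavyEnds≤∑lightEnds : sum heavyEnds ≤ sum lightEnds
  ∑heavyEnds≤∑lightEnds = ≤-trans (sum-mono-≤ (λ v → sum-mono-≤ (heavyEnd≤lightEnd v)))
                                  (≤-reflexive ∑lightEnd≡∑lightEnds)

  lightEnds≡heavyEnds : ∀ v → lightEnds v ≡ heavyEnds v
  lightEnds≡heavyEnds = sum-≤-tight (λ v → ≤-trans (lightEnds≤p v) (p≤heavyEnds v)) ∑heavyEnds≤∑lightEnds

  heavyEnds≡p : ∀ v → heavyEnds v ≡ p
  heavyEnds≡p v = ≤-antisym (subst (_≤ p) (lightEnds≡heavyEnds v) (lightEnds≤p v)) (p≤heavyEnds v)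

  lightEnds≡p : ∀ v → lightEnds v ≡ p
  lightEnds≡p v = trans (lightEnds≡heavyEnds v) (heavyEnds≡p v)

  light-at-one-end⇒heavy-at-other : Adj G v u → ¬ Heavy u v → Heavy v u
  light-at-one-end⇒heavy-at-other {v} {u} vu light-u =
    proj₂ (𝟙≡1⇒ (heavyEnd? v u) (trans (heavyEnd≡lightEnd v u) (𝟙-yes (lightEnd? u v) (Adj-sym G vu , light-u))))
    where
    heavyEnd≡lightEnd : ∀ v u → heavyEnd v u ≡ lightEnd v u
    heavyEnd≡lightEnd = sum₂-≤-tight heavyEnd≤lightEnd (begin
      sum (λ v → sum (lightEnd v)) ≡⟨ ∑lightEnd≡∑lightEnds ⟩
      sum lightEnds                ≡⟨ sum-cong-≗ lightEnds≡heavyEnds ⟩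
      sum heavyEnds                ∎)
      where open ≤-Reasoning

  module _ (v : V) where
    open Profile (deg v) (deg-own-colour v)

    -- Opaque: letting the type checker unfold this witness makes conversion checks very slow.
    opaque
      heavy-colour : ∃ λ J → 2 ≤ deg v J
      heavy-colour = heavy-pos⇒∃ (subst (0 <_) (trans (sym (heavyEnds≡p v)) (heavyEnds≡heavy v)) (≤-trans (s≤s z≤n) 2≤p))

    leafColour : Fin (p + 2)
    leafColour = proj₁ heavy-colour

    2≤deg-leafColour : 2 ≤ deg v leafColour
    2≤deg-leafColour = proj₂ heavy-colour

    leafColour≢colour : leafColour ≢ c v
    leafColour≢colour J≡cv = contradiction (subst (λ k → 2 ≤ deg v k) J≡cv 2≤deg-leafColour)
      (λ 2≤d → <⇒≱ 2≤d (≤-trans (≤-reflexive (deg-own-colour v)) z≤n))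

    private
      rest≤light : count (∁? ((_≟ c v) ∪? (_≟ leafColour))) ≤ light
      rest≤light = ≤-reflexive (trans (+-cancelʳ-≡ 2 _ p (count-∉₂ (leafColour≢colour ∘ sym)))
                                      (sym (trans (sym (lightEnds≡light v)) (lightEnds≡p v))))

    deg-other : k ≢ c v → k ≢ leafColour → deg v k ≡ 1
    deg-other {k} k≢cv k≢J = rest≤light⇒ones 2≤deg-leafColour rest≤light k [ k≢cv , k≢J ]

    deg-leafColour : deg v leafColour ≡ p
    deg-leafColour = trans (sym (rest≤light⇒heavy≡ 2≤deg-leafColour rest≤light))
                           (trans (sym (heavyEnds≡heavy v)) (heavyEnds≡p v))

  Heavy⇒leafColour : Adj G v u → Heavy v u → c u ≡ leafColour v
  Heavy⇒leafColour {v} {u} vu heavy with c u ≟ leafColour v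
  ... | yes cu≡J = cu≡J
  ... | no cu≢J  = contradiction (≤-reflexive (deg-other v (c-proper v u vu ∘ sym) cu≢J)) (<⇒≱ heavy)

  leafColour⇒Heavy : c u ≡ leafColour v → Heavy v u
  leafColour⇒Heavy {u} {v} cu≡J = subst (λ k → 2 ≤ deg v k) (sym cu≡J) (2≤deg-leafColour v)

  edge-orientation : Adj G v u → c u ≡ leafColour v ⊎ c v ≡ leafColour u
  edge-orientation {v} {u} vu with heavy? u (c v)
  ... | yes heavy-u = inj₂ (Heavy⇒leafColour (Adj-sym G vu) heavy-u)
  ... | no light-u  = inj₁ (Heavy⇒leafColour vu (light-at-one-end⇒heavy-at-other vu light-u))

  ¬both-orientations : Adj G v u → c u ≡ leafColour v → c v ≡ leafColour u → ⊥
  ¬both-orientations vu cu≡Jv cv≡Ju = ¬heavy-at-both-ends vu (leafColour⇒Heavy cu≡Jv) (leafColour⇒Heavy cv≡Ju)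

  Leaf : V → V → Set
  Leaf v u = Adj G v u × c u ≡ leafColour v

  leaf? : (v : V) → Decidable (Leaf v)
  leaf? v = colourNbr? v (leafColour v)

  leafCount : V → Fin (p + 2) → ℕ
  leafCount v k = count (leaf? v ∩? (λ u → leafColour u ≟ k))

  sum-leafCount : ∀ v → sum (leafCount v) ≡ p
  sum-leafCount v = trans (sym (count-fibres (leaf? v) leafColour)) (deg-leafColour v)

  leaves+neighbour⇒inducedStar : (∃ λ x → Adj G v x × c x ≡ k) → k ≢ leafColour v → leafCount v k ≡ 0 →
                                 InducedStar G (p + 1)
  leaves+neighbour⇒inducedStar {v} {k} (x , vx , cx≡k) k≢Jv leafCount≡0 =
    subst (InducedStar G) count-star (inducedStar-of-count G star? v star⊆N star-indep)
    where
    cv≡Jx : c v ≡ leafColour x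
    cv≡Jx with edge-orientation vx
    ... | inj₁ cx≡Jv = contradiction (trans (sym cx≡k) cx≡Jv) k≢Jv
    ... | inj₂ cv≡Jx = cv≡Jx

    star? : Decidable (λ y → Leaf v y ⊎ y ≡ x)
    star? = leaf? v ∪? (_≟ x)
    count-star : count star? ≡ p + 1
    count-star = trans (count-∪ (leaf? v) (_≟ x) (λ { (_ , cx≡Jv) refl → k≢Jv (trans (sym cx≡k) cx≡Jv) }))
                       (cong₂ _+_ (deg-leafColour v) (count-singleton x))
    star⊆N : ∀ {y} → Leaf v y ⊎ y ≡ x → Adj G v y
    star⊆N (inj₁ (vy , _)) = vy
    star⊆N (inj₂ refl)     = vx

    -- y ~ x would force leafColour y ≡ c x ≡ k (so leafCount v k > 0) or c y ≡ leafColour x ≡ c v.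
    leaf≁x : ∀ {y} → Leaf v y → ¬ Adj G y x
    leaf≁x {y} (vy , cy≡Jv) yx with edge-orientation yx
    ... | inj₁ cx≡Jy = count≡0⇒∉ (leaf? v ∩? (λ u → leafColour u ≟ k)) leafCount≡0
                                  ((vy , cy≡Jv) , trans (sym cx≡Jy) cx≡k)
    ... | inj₂ cy≡Jx = leafColour≢colour v (trans (sym cy≡Jv) (trans cy≡Jx (sym cv≡Jx)))
    star-indep : ∀ {y w} → Leaf v y ⊎ y ≡ x → Leaf v w ⊎ w ≡ x → ¬ Adj G y w
    star-indep {y} {w} (inj₁ (_ , cy≡Jv)) (inj₁ (_ , cw≡Jv)) yw = c-proper y w yw (trans cy≡Jv (sym cw≡Jv))
    star-indep (inj₁ leaf-y)       (inj₂ refl)          = leaf≁x leaf-y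
    star-indep (inj₂ refl)         (inj₁ leaf-w)        = leaf≁x leaf-w ∘ Adj-sym G
    star-indep (inj₂ refl)         (inj₂ refl)          = Adj-irrefl G

  leafCount-pos : k ≢ c v → k ≢ leafColour v → 0 < leafCount v k
  leafCount-pos {k} {v} k≢cv k≢Jv = n≢0⇒n>0 (K-free ∘ leaves+neighbour⇒inducedStar k-neighbour k≢Jv)
    where k-neighbour : ∃ λ x → Adj G v x × c x ≡ k
          k-neighbour = count-pos⇒∃ (colourNbr? v k) (≤-reflexive (sym (deg-other v k≢cv k≢Jv)))

  -- The p colours other than c v and leafColour v each occur at least once among the
  -- p leaves, hence exactly once.
  leafCount≤1 : ∀ v k → leafCount v k ≤ 1
  leafCount≤1 v k = subst (_≤ 1) (sum-≤-tight rest≤leafCount ∑leafCount≤rest k) (𝟙≤1 (rest? k))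
    where
    rest? : Decidable (λ k → ¬ (k ≡ c v ⊎ k ≡ leafColour v))
    rest? = ∁? ((_≟ c v) ∪? (_≟ leafColour v))
    rest≤leafCount : ∀ k → 𝟙 (rest? k) ≤ leafCount v k
    rest≤leafCount k with rest? k
    ... | yes k∉ = leafCount-pos (k∉ ∘ inj₁) (k∉ ∘ inj₂)
    ... | no _   = z≤n
    ∑leafCount≤rest : sum (leafCount v) ≤ count rest?
    ∑leafCount≤rest = ≤-reflexive (trans (sum-leafCount v)
      (sym (+-cancelʳ-≡ 2 _ p (count-∉₂ (leafColour≢colour v ∘ sym)))))

  ψ : V → Fin (p + 2) × Fin (p + 2)
  ψ v = c v , leafColour v

  ψ-hom : Adj G v u → LAdj (p + 2) (ψ v) (ψ u)
  ψ-hom {v} {u} vu with c u ≟ leafColour v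
  ... | yes cu≡Jv = inj₁ (sym cu≡Jv , λ Ju≡cv → ¬both-orientations vu cu≡Jv (sym Ju≡cv))
  ... | no cu≢Jv with edge-orientation vu
  ...   | inj₁ cu≡Jv = contradiction cu≡Jv cu≢Jv
  ...   | inj₂ cv≡Ju = inj₂ (sym cv≡Ju , cu≢Jv)

  ψ-injective-on-N : Adj G v u → Adj G v w → ψ u ≡ ψ w → u ≡ w
  ψ-injective-on-N {v} {u} {w} vu vw ψu≡ψw with c u ≟ leafColour v
  ... | yes cu≡Jv = count≤1⇒unique (leaf? v ∩? (λ y → leafColour y ≟ leafColour u)) (leafCount≤1 v (leafColour u))
                      ((vu , cu≡Jv) , refl) ((vw , trans (sym cu≡cw) cu≡Jv) , sym (cong proj₂ ψu≡ψw))
    where cu≡cw : c u ≡ c w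
          cu≡cw = cong proj₁ ψu≡ψw
  ... | no cu≢Jv  = count≤1⇒unique (colourNbr? v (c u)) (≤-reflexive (deg-other v (c-proper v u vu ∘ sym) cu≢Jv))
                      (vu , refl) (vw , sym (cong proj₁ ψu≡ψw))

  ψ-onto-N : ∀ y → LValid (p + 2) y → LAdj (p + 2) (ψ v) y → ∃ λ u → Adj G v u × ψ u ≡ y
  ψ-onto-N {v} (y₁ , y₂) y₁≢y₂ (inj₁ (Jv≡y₁ , y₂≢cv)) =
    from-leaf (count-pos⇒∃ (leaf? v ∩? (λ u → leafColour u ≟ y₂))
                           (leafCount-pos y₂≢cv (λ y₂≡Jv → y₁≢y₂ (trans (sym Jv≡y₁) (sym y₂≡Jv)))))
    where
    from-leaf : (∃ λ u → Leaf v u × leafColour u ≡ y₂) → ∃ λ u → Adj G v u × ψ u ≡ (y₁ , y₂)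
    from-leaf (u , (vu , cu≡Jv) , Ju≡y₂) = u , vu , ×-≡,≡→≡ (trans cu≡Jv Jv≡y₁ , Ju≡y₂)
  ψ-onto-N {v} (y₁ , y₂) y₁≢y₂ (inj₂ (y₂≡cv , y₁≢Jv)) =
    from-neighbour (count-pos⇒∃ (colourNbr? v y₁)
                                (≤-reflexive (sym (deg-other v (λ y₁≡cv → y₁≢y₂ (trans y₁≡cv (sym y₂≡cv))) y₁≢Jv))))
    where
    from-neighbour : (∃ λ u → Adj G v u × c u ≡ y₁) → ∃ λ u → Adj G v u × ψ u ≡ (y₁ , y₂)
    from-neighbour (u , vu , cu≡y₁) with edge-orientation vu
    ... | inj₁ cu≡Jv = contradiction (trans (sym cu≡y₁) cu≡Jv) y₁≢Jv
    ... | inj₂ cv≡Ju = u , vu , ×-≡,≡→≡ (cu≡y₁ , trans (sym cv≡Ju) (sym y₂≡cv))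

  ψ-locallyBijective : LocallyBijectiveToL* G (p + 2) ψ
  ψ-locallyBijective = (λ v → leafColour≢colour v ∘ sym) ,
                       (λ v → (λ u → ψ-hom) , (λ u w → ψ-injective-on-N) , ψ-onto-N)

theorem13 : (p : ℕ) → 2 ≤ p → (G : Graph) →
    Free-K1 G (p + 1) → Regular G (2 * p) →
    StarColourable G (p + 2) ⇔ Σ (Fin (Graph.n G) → Fin (p + 2) × Fin (p + 2)) (LocallyBijectiveToL* G (p + 2))
theorem13 p 2≤p G K-free regular = mk⇔
  (λ (c , c-star) → let open FromStarColouring p 2≤p G K-free regular c c-star in ψ , ψ-locallyBijective)
  (λ (ψ , ψ-lb) → let open FromLocallyBijective G (p + 2) ψ ψ-lb in colour , star-colouring)
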